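{- Let $H=(V,E)$ be a connected hypergraph with $|V|\ge 2$, in which every edge has cardinality at least $2$ and every vertex has degree at least $2$. Then the following are equivalent: (1) $H$ has no separating vertices and no cut edges; (2) every pair of distinct elements from $V\cup E$ lie on a common cycle; (3) every pair of distinct vertices lie on a common cycle; (4) every pair of distinct edges lie on a common cycle.
   Context: A hypergraph $H=(V,E)$ consists of a nonempty finite vertex set $V$, a finite edge set $E$, and an incidence function $\psi:E\to 2^V$; edges are identified with their vertex sets (parallel edges allowed); the degree of a vertex is the number of edges containing it. Two distinct vertices are adjacent via $e$ if both lie in $e$; a walk is a sequence $v_0e_1v_1\dots e_kv_k$ with $v_{i-1},v_i$ adjacent via $e_i$; $H$ is connected if any two distinct vertices are joined by a walk. A cycle is a walk $v_0e_1v_1\dots e_kv_k$ with $k\ge2$, $v_0=v_k$, $v_0,\dots,v_{k-1}$ pairwise distinct and $e_1,\dots,e_k$ pairwise distinct; a vertex (edge) lies on it if it is one of the $v_i$ (one of the $e_i$). For an equivalence class $V'$ of "joined by a walk", the connected component is $(V',\{f\in E:\emptyset\ne f\subseteq V'\})$; $\omega(H)$ is the number of components. $H-e=(V,E\setminus\{e\})$; $e$ is a cut edge if $\omega(H-e)>\omega(H)$. A hypersubgraph is $(V',E')$ with $V'\subseteq V$, $E'\subseteq E$. A vertex $v$ is a separating vertex of $H$ if there are two connected hypersubgraphs $H_1,H_2$, each with at least one edge, with $E(H_1)\cap E(H_2)=\emptyset$, $V=V(H_1)\cup V(H_2)$, $E=E(H_1)\cup E(H_2)$, and $V(H_1)\cap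 V(H_2)=\{v\}$. -}

module Defs where

open import Data.Nat using (ℕ; _≤_; _<_)
open import Data.Fin using (Fin)
open import Data.Fin.Subset using (Subset; _∈_; _⊆_; ⊤; ⁅_⁆; _∩_; _∪_; _-_; ∣_∣; Nonempty; Empty)
open import Data.Vec using (lookup; tabulate)
open import Data.List using (List; []; _∷_; length)
open import Data.List.Membership.Propositional renaming (_∈_ to _∈ₗ_)
open import Data.List.Relation.Unary.Unique.Propositional using (Unique)
open import Data.Product using (Σ; ∃; _×_)
open import Data.Sum using (_⊎_; inj₁; inj₂)
open import Relation.Binary.PropositionalEquality using (_≡_; _≢_)
open import Relation.Nullary using (¬_)
open import Function.Bundles using (_⇔_)

-- A hypergraph with vertex set Fin n and edge set Fin m is given by its
-- incidence function ψ : Fin m → Subset n (parallel edges allowed).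

module _ {n m : ℕ} (ψ : Fin m → Subset n) where

  degree : Fin n → ℕ
  degree v = ∣ tabulate (λ e → lookup (ψ e) v) ∣

  AdjVia : Fin m → Fin n → Fin n → Set
  AdjVia e u w = (u ≢ w) × (u ∈ ψ e) × (w ∈ ψ e)

  -- walks using only edges from the edge set Es
  -- (Walk ψ ⊤ is a walk in H; Walk ψ (⊤ - e) is a walk in H - e)
  data Walk (Es : Subset m) : Fin n → Fin n → Set where
    []   : ∀ {v} → Walk Es v v
    step : ∀ {u w v} (e : Fin m) → e ∈ Es → AdjVia e u w → Walk Es w v → Walk Es u v

  edgesOf : ∀ {Es u v} → Walk Es u v → List (Fin m)
  edgesOf []               = []
  edgesOf (step e _ _ w)   = e ∷ edgesOf w

  vertsInit : ∀ {Es u v} → Walk Es u v → List (Fin n)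
  vertsInit [] = []
  vertsInit {u = u} (step _ _ _ w) = u ∷ vertsInit w

  record Cycle : Set where
    field
      base   : Fin n
      walk   : Walk ⊤ base base
      long   : 2 ≤ length (edgesOf walk)
      vdist  : Unique (vertsInit walk)
      edist  : Unique (edgesOf walk)

  VertexOn : Fin n → Cycle → Set
  VertexOn x C = x ∈ₗ vertsInit (Cycle.walk C)

  EdgeOn : Fin m → Cycle → Set
  EdgeOn e C = e ∈ₗ edgesOf (Cycle.walk C)

  ElemOn : Fin n ⊎ Fin m → Cycle → Set
  ElemOn (inj₁ v) C = VertexOn v C
  ElemOn (inj₂ e) C = EdgeOn e C

  Connected : Set
  Connected = ∀ (u v : Fin n) → u ≢ v → Walk ⊤ u v

  NumComponents : Subset m → ℕ → Set
  NumComponents Es c =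
    Σ (Fin n → Fin c) λ f →
      (∀ i → ∃ λ v → f v ≡ i) ×
      (∀ u v → (f u ≡ f v) ⇔ Walk Es u v)

  CutEdge : Fin m → Set
  CutEdge e = ∃ λ c → ∃ λ c' → NumComponents ⊤ c × NumComponents (⊤ - e) c' × c < c'

  ConnectedSub : Subset n → Subset m → Set
  ConnectedSub Vs Es =
    (∀ e → e ∈ Es → ψ e ⊆ Vs) ×
    (∀ u w → u ∈ Vs → w ∈ Vs → u ≢ w → Walk Es u w)

  SeparatingVertex : Fin n → Set
  SeparatingVertex v =
    ∃ λ V₁ → ∃ λ E₁ → ∃ λ V₂ → ∃ λ E₂ →
      ConnectedSub V₁ E₁ × ConnectedSub V₂ E₂ ×
      Nonempty E₁ × Nonempty E₂ ×
      Empty (E₁ ∩ E₂) ×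
      (V₁ ∪ V₂ ≡ ⊤) × (E₁ ∪ E₂ ≡ ⊤) ×
      (V₁ ∩ V₂ ≡ ⁅ v ⁆)

  Cond1 : Set
  Cond1 = (∀ v → ¬ SeparatingVertex v) × (∀ e → ¬ CutEdge e)

  Cond2 : Set
  Cond2 = ∀ (x y : Fin n ⊎ Fin m) → x ≢ y → Σ Cycle λ C → ElemOn x C × ElemOn y C

  Cond3 : Set
  Cond3 = ∀ (u v : Fin n) → u ≢ v → Σ Cycle λ C → VertexOn u C × VertexOn v C

  Cond4 : Set
  Cond4 = ∀ (e f : Fin m) → e ≢ f → Σ Cycle λ C → EdgeOn e C × EdgeOn f C

module Submission where

-- The incidence graph B of H has the vertices and the edges of H as nodes, a vertex being
-- adjacent to the edges containing it; the cycles of H are the cycles of B, read alternately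
-- as vertices and edges. All four conditions say that B is 2-connected. For (1): a node whose
-- removal disconnects B is a separating vertex or a cut edge of H, and conversely. For (2)-(4):
-- by Whitney's theorem 2-connectivity puts any two nodes on a common cycle, grown one step at a
-- time along a path (the size and degree hypotheses give every node two neighbours); conversely,
-- if x separated a from b, no cycle could pass near both a and b, as both of its arcs would
-- have to cross x.

open import Data.Nat using (ℕ; zero; suc; _≤_; z≤n; s≤s; s≤s⁻¹; _+_)
open import Data.Nat.Properties using (≤-trans; ≤-refl; +-mono-≤; <⇒≤)
open import Data.Bool using (Bool; true; false)
open import Data.Fin using (Fin) renaming (zero to fzero; suc to fsuc)
import Data.Fin as Fin
open import Data.Fin.Properties using (suc-injective) renaming (any? to anyFin?)
open import Data.Fin.Subset
  using (Subset; ⊤; ⁅_⁆; _∩_; _∪_; _-_; ∣_∣; Nonempty)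
  renaming (_∈_ to _∈ˢ_; _⊆_ to _⊆ˢ_)
open import Data.Fin.Subset.Properties
  using (∈⊤; ⊆-antisym; ⊆-max; x∈⁅x⁆; x∈⁅y⁆⇒x≡y; x∈p∩q⁺; x∈p∩q⁻; x∈p∪q⁺; x∈p∪q⁻; x∈p∧x≢y⇒x∈p-y)
  renaming (_∈?_ to _∈ˢ?_)
open import Data.Vec using (_∷_; here; there; lookup; tabulate)
open import Data.Vec.Properties using (lookup∘tabulate; []=⇒lookup; lookup⇒[]=)
open import Data.List using (List; []; _∷_; _++_; length; reverse; [_]; filter; map; allFin)
open import Data.List.Properties
  using (++-assoc; unfold-reverse; length-++; length-++-comm; length-reverse; filter-notAll)
open import Data.List.Membership.Propositional using (_∈_; _∉_; lose)
open import Data.List.Membership.Propositional.Properties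
  using (∈-++⁺ˡ; ∈-++⁺ʳ; ∈-++⁻; ∈-filter⁺; ∈-filter⁻; ∈-allFin; ∈-map⁺)
import Data.List.Membership.DecPropositional as DecMembership
open import Data.List.Relation.Binary.Subset.Propositional using (_⊆_)
open import Data.List.Relation.Binary.Disjoint.Propositional using (Disjoint)
open import Data.List.Relation.Unary.Any as Any using (Any; here; there; any?; satisfied)
import Data.List.Relation.Unary.Any.Properties as AnyP
open import Data.List.Relation.Unary.All.Properties using (¬Any⇒All¬)
open import Data.List.Relation.Unary.AllPairs using ([]; _∷_)
open import Data.List.Relation.Unary.Unique.Propositional using (Unique)
open import Data.List.Relation.Unary.Unique.Propositional.Properties
  using (Unique[x∷xs]⇒x∉xs) renaming (++⁺ to Unique-++⁺)
open import Data.Product using (Σ; ∃; _×_; _,_; proj₁; proj₂)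
open import Data.Sum using (_⊎_; inj₁; inj₂; [_,_]′)
open import Data.Sum.Properties using (≡-dec; inj₁-injective; inj₂-injective)
open import Data.Empty using (⊥; ⊥-elim)
open import Function using (_∘_)
open import Function.Bundles using (_⇔_; mk⇔; Equivalence)
open import Relation.Nullary using (¬_; Dec; yes; no; does; contradiction)
open import Relation.Nullary.Decidable using (map′; ¬?; _⊎-dec_; _×-dec_; dec-true)
open import Relation.Unary using (Decidable)
open import Relation.Binary.Definitions using (DecidableEquality; Reflexive; Symmetric; Transitive)
open import Relation.Binary.PropositionalEquality
  using (_≡_; _≢_; refl; sym; trans; cong; subst; module ≡-Reasoning)

open import Defs

module _ {A : Set} where

  Unique-∷⁺ : ∀ {x : A} {xs} → x ∉ xs → Unique xs → Unique (x ∷ xs)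
  Unique-∷⁺ {xs = xs} x∉xs u = ¬Any⇒All¬ xs x∉xs ∷ u

  Unique-tail : ∀ {x : A} {xs} → Unique (x ∷ xs) → Unique xs
  Unique-tail (_ ∷ u) = u

  Unique-++⁻ : ∀ (xs : List A) {ys} → Unique (xs ++ ys) → Unique xs × Unique ys × Disjoint xs ys
  Unique-++⁻ []       u = [] , u , λ ()
  Unique-++⁻ (x ∷ xs) u with Unique-++⁻ xs (Unique-tail u)
  ... | uxs , uys , disj = Unique-∷⁺ (x∉ ∘ ∈-++⁺ˡ) uxs , uys , disj′
    where
      x∉ : x ∉ xs ++ _
      x∉ = Unique[x∷xs]⇒x∉xs u
      disj′ : Disjoint (x ∷ xs) _
      disj′ (here refl , y∈ys) = x∉ (∈-++⁺ʳ xs y∈ys)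
      disj′ (there z∈xs , z∈ys) = disj (z∈xs , z∈ys)

  Unique-++-comm : ∀ (xs : List A) {ys} → Unique (xs ++ ys) → Unique (ys ++ xs)
  Unique-++-comm xs u with Unique-++⁻ xs u
  ... | uxs , uys , disj = Unique-++⁺ uys uxs (λ (z∈ys , z∈xs) → disj (z∈xs , z∈ys))

  Unique-reverse⁺ : ∀ {xs : List A} → Unique xs → Unique (reverse xs)
  Unique-reverse⁺ {[]}     u = []
  Unique-reverse⁺ {x ∷ xs} u rewrite unfold-reverse x xs =
    Unique-++⁺ (Unique-reverse⁺ (Unique-tail u)) (Unique-∷⁺ (λ ()) [])
      λ { (z∈rev , here refl) → Unique[x∷xs]⇒x∉xs u (AnyP.reverse⁻ z∈rev) }

length-++-≥ : ∀ {A : Set} (xs : List A) {ys i j} →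
              i ≤ length xs → j ≤ length ys → i + j ≤ length (xs ++ ys)
length-++-≥ xs i≤ j≤ = subst (_ ≤_) (sym (length-++ xs)) (+-mono-≤ i≤ j≤)

length-∈ : ∀ {A : Set} {x : A} {xs} → x ∈ xs → 1 ≤ length xs
length-∈ (here _)  = s≤s z≤n
length-∈ (there _) = s≤s z≤n

module _ {k : ℕ} where

  ∈-tabulate⁺ : ∀ {f : Fin k → Bool} {i} → f i ≡ true → i ∈ˢ tabulate f
  ∈-tabulate⁺ {f} {i} fi≡true = lookup⇒[]= i _ (trans (lookup∘tabulate f i) fi≡true)

  ∈-tabulate⁻ : ∀ {f : Fin k → Bool} {i} → i ∈ˢ tabulate f → f i ≡ true
  ∈-tabulate⁻ {f} {i} i∈ = trans (sym (lookup∘tabulate f i)) ([]=⇒lookup i∈)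

  subsetOf : ∀ {P : Fin k → Set} → Decidable P → Subset k
  subsetOf P? = tabulate (does ∘ P?)

  ∈-subsetOf⁺ : ∀ {P} (P? : Decidable P) {i} → P i → i ∈ˢ subsetOf P?
  ∈-subsetOf⁺ P? {i} p = ∈-tabulate⁺ (dec-true (P? i) p)

  ∈-subsetOf⁻ : ∀ {P} (P? : Decidable P) {i} → i ∈ˢ subsetOf P? → P i
  ∈-subsetOf⁻ P? {i} i∈ with P? i | ∈-tabulate⁻ {does ∘ P?} i∈
  ... | yes p | _ = p

∣p∣≥1⇒nonempty : ∀ {k} (p : Subset k) → 1 ≤ ∣ p ∣ → Nonempty p
∣p∣≥1⇒nonempty (true  ∷ p) _ = fzero , here
∣p∣≥1⇒nonempty (false ∷ p) 1≤∣p∣ with ∣p∣≥1⇒nonempty p 1≤∣p∣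
... | i , i∈p = fsuc i , there i∈p

∣p∣≥2⇒∃≢ : ∀ {k} (p : Subset k) → 2 ≤ ∣ p ∣ → ∀ j → ∃ λ i → i ∈ˢ p × i ≢ j
∣p∣≥2⇒∃≢ (true ∷ p) 2≤∣p∣ fzero with ∣p∣≥1⇒nonempty p (s≤s⁻¹ 2≤∣p∣)
... | i , i∈p = fsuc i , there i∈p , λ ()
∣p∣≥2⇒∃≢ (true  ∷ p) _ (fsuc j) = fzero , here , λ ()
∣p∣≥2⇒∃≢ (false ∷ p) 2≤∣p∣ fzero with ∣p∣≥1⇒nonempty p (<⇒≤ 2≤∣p∣)
... | i , i∈p = fsuc i , there i∈p , λ ()
∣p∣≥2⇒∃≢ (false ∷ p) 2≤∣p∣ (fsuc j) with ∣p∣≥2⇒∃≢ p 2≤∣p∣ j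
... | i , i∈p , i≢j = fsuc i , there i∈p , i≢j ∘ suc-injective

x∉p-x : ∀ {k} (p : Subset k) x → ¬ (x ∈ˢ p - x)
x∉p-x (true  ∷ p) fzero ()
x∉p-x (false ∷ p) fzero ()
x∉p-x (_ ∷ p) (fsuc x) (there x∈) = x∉p-x p x x∈

NumClasses : ∀ {k} → (Fin k → Fin k → Set) → ℕ → Set
NumClasses {k} R c =
  Σ (Fin k → Fin c) λ f → (∀ i → ∃ λ v → f v ≡ i) × (∀ u v → (f u ≡ f v) ⇔ R u v)

numberClasses : ∀ {k} (R : Fin k → Fin k → Set) → (∀ i j → Dec (R i j)) →
                Reflexive R → Symmetric R → Transitive R → ∃ (NumClasses R)
numberClasses {zero}  R R? refl′ sym′ trans′ = 0 , (λ ()) , (λ ()) , (λ ())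
numberClasses {suc k} R R? refl′ sym′ trans′
  with numberClasses (λ i j → R (fsuc i) (fsuc j)) (λ i j → R? (fsuc i) (fsuc j)) refl′ sym′ trans′
     | anyFin? (λ j → R? fzero (fsuc j))
... | c , f , f-onto , f-classes | yes (j₀ , R0j₀) = c , g , g-onto , g-classes
  where
    g : Fin (suc k) → Fin c
    g fzero    = f j₀
    g (fsuc i) = f i
    g-onto : ∀ i → ∃ λ v → g v ≡ i
    g-onto i with f-onto i
    ... | v , fv≡i = fsuc v , fv≡i
    g-classes : ∀ u v → (g u ≡ g v) ⇔ R u v
    g-classes fzero    fzero    = mk⇔ (λ _ → refl′) (λ _ → refl)
    g-classes fzero    (fsuc v) = mk⇔ (trans′ R0j₀ ∘ Equivalence.to (f-classes j₀ v))
                                      (Equivalence.from (f-classes j₀ v) ∘ trans′ (sym′ R0j₀))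
    g-classes (fsuc u) fzero    = mk⇔ (λ eq → trans′ (Equivalence.to (f-classes u j₀) eq) (sym′ R0j₀))
                                      (λ r → Equivalence.from (f-classes u j₀) (trans′ r R0j₀))
    g-classes (fsuc u) (fsuc v) = f-classes u v
... | c , f , f-onto , f-classes | no ¬R0 = suc c , g , g-onto , g-classes
  where
    g : Fin (suc k) → Fin (suc c)
    g fzero    = fzero
    g (fsuc i) = fsuc (f i)
    g-onto : ∀ i → ∃ λ v → g v ≡ i
    g-onto fzero = fzero , refl
    g-onto (fsuc i) with f-onto i
    ... | v , fv≡i = fsuc v , cong fsuc fv≡i
    g-classes : ∀ u v → (g u ≡ g v) ⇔ R u v
    g-classes fzero    fzero    = mk⇔ (λ _ → refl′) (λ _ → refl)
    g-classes fzero    (fsuc v) = mk⇔ (λ ()) (λ r → contradiction (v , r) ¬R0)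
    g-classes (fsuc u) fzero    = mk⇔ (λ ()) (λ r → contradiction (u , sym′ r) ¬R0)
    g-classes (fsuc u) (fsuc v) = mk⇔ (Equivalence.to (f-classes u v) ∘ suc-injective)
                                      (cong fsuc ∘ Equivalence.from (f-classes u v))

numClasses-total : ∀ {k} {R : Fin k → Fin k → Set} → (∀ u v → R u v) → Fin k → NumClasses R 1
numClasses-total total v₀ =
  (λ _ → fzero) , (λ { fzero → v₀ , refl }) , λ u v → mk⇔ (λ _ → total u v) (λ _ → refl)

numClasses-total⇒≤1 : ∀ {k c} {R : Fin k → Fin k → Set} → NumClasses R c → (∀ u v → R u v) → c ≤ 1
numClasses-total⇒≤1 {c = zero}        _ _ = z≤n
numClasses-total⇒≤1 {c = suc zero}    _ _ = s≤s z≤n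
numClasses-total⇒≤1 {c = suc (suc c)} (f , f-onto , f-classes) total
  with f-onto fzero | f-onto (fsuc fzero)
... | u , fu≡0 | v , fv≡1
  with () ← trans (sym fu≡0) (trans (Equivalence.from (f-classes u v) (total u v)) fv≡1)

numClasses-separated⇒≥2 : ∀ {k c} {R : Fin k → Fin k → Set} → NumClasses R c →
                          ∀ {u v} → ¬ R u v → 2 ≤ c
numClasses-separated⇒≥2 {c = zero} (f , _) {u} _ with () ← f u
numClasses-separated⇒≥2 {c = suc zero} (f , _ , f-classes) {u} {v} ¬Ruv
  with f u | f v | Equivalence.to (f-classes u v)
... | fzero | fzero | to = contradiction (to refl) ¬Ruv
numClasses-separated⇒≥2 {c = suc (suc c)} _ _ = s≤s (s≤s z≤n)

numClasses-resp-⇔ : ∀ {k c} {R R′ : Fin k → Fin k → Set} → (∀ u v → R u v ⇔ R′ u v) →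
                    NumClasses R c → NumClasses R′ c
numClasses-resp-⇔ R⇔R′ (f , f-onto , f-classes) =
  f , f-onto , λ u v → mk⇔ (Equivalence.to (R⇔R′ u v) ∘ Equivalence.to (f-classes u v))
                           (Equivalence.from (f-classes u v) ∘ Equivalence.from (R⇔R′ u v))

module Graph {N : Set} (_≟_ : DecidableEquality N)
             (Adj : N → N → Set) (Adj? : ∀ a b → Dec (Adj a b))
             (Adj-sym : ∀ {a b} → Adj a b → Adj b a) (Adj-irrefl : ∀ {a} → ¬ Adj a a)
             (enum : List N) (∈-enum : ∀ a → a ∈ enum) where

  open DecMembership _≟_ using (_∈?_)

  infixr 5 _∷ₚ_ _++ₚ_

  data Path : N → N → Set where
    []ₚ  : ∀ {a} → Path a a
    _∷ₚ_ : ∀ {a b c} → Adj a b → Path b c → Path a c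

  nodesInit : ∀ {a b} → Path a b → List N
  nodesInit []ₚ            = []
  nodesInit (_∷ₚ_ {a} _ p) = a ∷ nodesInit p

  nodes : ∀ {a b} → Path a b → List N
  nodes {b = b} p = nodesInit p ++ [ b ]

  start∈ : ∀ {a b} (p : Path a b) → a ∈ nodes p
  start∈ []ₚ      = here refl
  start∈ (_ ∷ₚ _) = here refl

  end∈ : ∀ {a b} (p : Path a b) → b ∈ nodes p
  end∈ p = ∈-++⁺ʳ (nodesInit p) (here refl)

  nodesInit⊆nodes : ∀ {a b} (p : Path a b) → nodesInit p ⊆ nodes p
  nodesInit⊆nodes p = ∈-++⁺ˡ

  ∈-nodes⇒∈-nodesInit : ∀ {a b x} (p : Path a b) → x ∈ nodes p → x ≢ b → x ∈ nodesInit p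
  ∈-nodes⇒∈-nodesInit p x∈ x≢b with ∈-++⁻ (nodesInit p) x∈
  ... | inj₁ x∈init     = x∈init
  ... | inj₂ (here x≡b) = contradiction x≡b x≢b

  _++ₚ_ : ∀ {a b c} → Path a b → Path b c → Path a c
  []ₚ      ++ₚ q = q
  (h ∷ₚ p) ++ₚ q = h ∷ₚ (p ++ₚ q)

  nodesInit-++ : ∀ {a b c} (p : Path a b) (q : Path b c) →
                 nodesInit (p ++ₚ q) ≡ nodesInit p ++ nodesInit q
  nodesInit-++ []ₚ            q = refl
  nodesInit-++ (_∷ₚ_ {a} _ p) q = cong (a ∷_) (nodesInit-++ p q)

  nodes-++ : ∀ {a b c} (p : Path a b) (q : Path b c) → nodes (p ++ₚ q) ≡ nodesInit p ++ nodes q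
  nodes-++ {c = c} p q = trans (cong (_++ [ c ]) (nodesInit-++ p q)) (++-assoc (nodesInit p) _ _)

  ∈-nodes-++⁻ : ∀ {a b c x} (p : Path a b) (q : Path b c) →
                x ∈ nodes (p ++ₚ q) → x ∈ nodes p ⊎ x ∈ nodes q
  ∈-nodes-++⁻ p q x∈ with ∈-++⁻ (nodesInit p) (subst (_ ∈_) (nodes-++ p q) x∈)
  ... | inj₁ x∈p = inj₁ (nodesInit⊆nodes p x∈p)
  ... | inj₂ x∈q = inj₂ x∈q

  reverseₚ : ∀ {a b} → Path a b → Path b a
  reverseₚ []ₚ      = []ₚ
  reverseₚ (h ∷ₚ p) = reverseₚ p ++ₚ (Adj-sym h ∷ₚ []ₚ)

  nodes-reverse : ∀ {a b} (p : Path a b) → nodes (reverseₚ p) ≡ reverse (nodes p)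
  nodes-reverse []ₚ = refl
  nodes-reverse (_∷ₚ_ {a} h p) = begin
    nodes (reverseₚ p ++ₚ (Adj-sym h ∷ₚ []ₚ))  ≡⟨ nodes-++ (reverseₚ p) _ ⟩
    nodesInit (reverseₚ p) ++ _ ∷ [ a ]       ≡⟨ ++-assoc (nodesInit (reverseₚ p)) _ [ a ] ⟨
    nodes (reverseₚ p) ++ [ a ]               ≡⟨ cong (_++ [ a ]) (nodes-reverse p) ⟩
    reverse (nodes p) ++ [ a ]                ≡⟨ unfold-reverse a (nodes p) ⟨
    reverse (a ∷ nodes p)                     ∎
    where open ≡-Reasoning

  ∈-nodes-reverse⁻ : ∀ {a b x} (p : Path a b) → x ∈ nodes (reverseₚ p) → x ∈ nodes p
  ∈-nodes-reverse⁻ p x∈ = AnyP.reverse⁻ (subst (_ ∈_) (nodes-reverse p) x∈)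

  splitAt : ∀ {a b x} (p : Path a b) → x ∈ nodes p →
            Σ (Path a x) λ p₁ → Σ (Path x b) λ p₂ → p ≡ p₁ ++ₚ p₂
  splitAt []ₚ      (here refl)  = []ₚ , []ₚ , refl
  splitAt (h ∷ₚ p) (here refl)  = []ₚ , h ∷ₚ p , refl
  splitAt (h ∷ₚ p) (there x∈p) with splitAt p x∈p
  ... | p₁ , p₂ , refl = h ∷ₚ p₁ , p₂ , refl

  Simple : ∀ {a b} → Path a b → Set
  Simple p = Unique (nodes p)

  Simple⇒Unique-nodesInit : ∀ {a b} (p : Path a b) → Simple p → Unique (nodesInit p)
  Simple⇒Unique-nodesInit p u = proj₁ (Unique-++⁻ (nodesInit p) u)

  Simple⇒end∉nodesInit : ∀ {a b} (p : Path a b) → Simple p → b ∉ nodesInit p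
  Simple⇒end∉nodesInit p u b∈ = proj₂ (proj₂ (Unique-++⁻ (nodesInit p) u)) (b∈ , here refl)

  loopErase : ∀ {a b} (p : Path a b) → Σ (Path a b) λ q → Simple q × nodes q ⊆ nodes p
  loopErase []ₚ = []ₚ , Unique-∷⁺ (λ ()) [] , λ x∈ → x∈
  loopErase (_∷ₚ_ {a} h p) with loopErase p
  ... | q , q-simple , q⊆p with a ∈? nodes q
  ...   | no a∉q =
    h ∷ₚ q , Unique-∷⁺ a∉q q-simple , λ { (here refl) → here refl ; (there x∈) → there (q⊆p x∈) }
  ...   | yes a∈q with splitAt q a∈q
  ...     | q₁ , q₂ , refl rewrite nodes-++ q₁ q₂ =
    q₂ , proj₁ (proj₂ (Unique-++⁻ (nodesInit q₁) q-simple)) , there ∘ q⊆p ∘ ∈-++⁺ʳ (nodesInit q₁)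

  PathWithin : List N → N → N → Set
  PathWithin S a b = Σ (Path a b) λ p → nodes p ⊆ S

  private
    without : N → List N → List N
    without a = filter (λ y → ¬? (y ≟ a))

    ∈-without⁺ : ∀ {a y S} → y ∈ S → y ≢ a → y ∈ without a S
    ∈-without⁺ = ∈-filter⁺ (λ y → ¬? (y ≟ _))

    ∈-without⁻ : ∀ {a y} S → y ∈ without a S → y ∈ S × y ≢ a
    ∈-without⁻ S = ∈-filter⁻ (λ y → ¬? (y ≟ _)) {xs = S}

    -- After loop erasure the path never returns to a, so its tail stays in S without a.
    firstStepWithin : ∀ {S a b} → PathWithin S a b → a ≢ b →
                      ∃ λ y → Adj a y × PathWithin (without a S) y b
    firstStepWithin (p , p⊆S) a≢b with loopErase p
    ... | []ₚ , _ , _ = contradiction refl a≢b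
    ... | h ∷ₚ q , hq-simple , hq⊆p =
      _ , h , q , λ z∈q → ∈-without⁺ (p⊆S (hq⊆p (there z∈q)))
                            λ { refl → Unique[x∷xs]⇒x∉xs hq-simple z∈q }

  -- Depth-first search: the budget k bounds the length of S, from which the start node is removed.
  pathWithin? : ∀ k S → length S ≤ k → ∀ a b → Dec (PathWithin S a b)
  pathWithin? k S ∣S∣≤k a b with a ∈? S
  ... | no a∉S = no λ (p , p⊆S) → a∉S (p⊆S (start∈ p))
  ... | yes a∈S with a ≟ b
  ...   | yes refl = yes ([]ₚ , λ { (here refl) → a∈S })
  pathWithin? zero    []      _ a b | yes () | no _
  pathWithin? (suc k) S ∣S∣≤k a b | yes a∈S | no a≢b =
    map′ viaStep (λ pw → lose (∈-enum _) (proj₂ (firstStepWithin pw a≢b)))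
         (any? (λ y → Adj? a y ×-dec pathWithin? k (without a S) ∣S′∣≤k y b) enum)
    where
      ∣S′∣≤k : length (without a S) ≤ k
      ∣S′∣≤k = s≤s⁻¹ (≤-trans (filter-notAll _ S (Any.map (λ { refl a≢a → a≢a refl }) a∈S)) ∣S∣≤k)
      viaStep : Any (λ y → Adj a y × PathWithin (without a S) y b) enum → PathWithin S a b
      viaStep some with satisfied some
      ... | _ , a~y , q , q⊆ =
        a~y ∷ₚ q , λ { (here refl) → a∈S ; (there z∈q) → proj₁ (∈-without⁻ S (q⊆ z∈q)) }

  PathAvoiding : N → N → N → Set
  PathAvoiding x a b = Σ (Path a b) λ p → x ∉ nodes p

  pathAvoiding? : ∀ x a b → Dec (PathAvoiding x a b)
  pathAvoiding? x a b =
    map′ (λ (p , p⊆) → p , λ x∈ → proj₂ (∈-without⁻ enum (p⊆ x∈)) refl)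
         (λ (p , x∉p) → p , λ {z} z∈ → ∈-without⁺ (∈-enum z) λ { refl → x∉p z∈ })
         (pathWithin? _ (without x enum) ≤-refl a b)

  avoiding-refl : ∀ {x a} → a ≢ x → PathAvoiding x a a
  avoiding-refl a≢x = []ₚ , λ { (here x≡a) → a≢x (sym x≡a) }

  avoiding-sym : ∀ {x a b} → PathAvoiding x a b → PathAvoiding x b a
  avoiding-sym (p , x∉p) = reverseₚ p , x∉p ∘ ∈-nodes-reverse⁻ p

  avoiding-trans : ∀ {x a b c} → PathAvoiding x a b → PathAvoiding x b c → PathAvoiding x a c
  avoiding-trans (p , x∉p) (q , x∉q) = p ++ₚ q , [ x∉p , x∉q ]′ ∘ ∈-nodes-++⁻ p q

  avoiding-step : ∀ {x a b c} → PathAvoiding x a b → Adj b c → c ≢ x → PathAvoiding x a c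
  avoiding-step (p , x∉p) b~c c≢x =
    avoiding-trans (p , x∉p)
      (b~c ∷ₚ []ₚ , λ { (here refl) → x∉p (end∈ p) ; (there (here refl)) → c≢x refl })

  avoiding-prefix : ∀ {x a z y} (p : Path a z) → x ∉ nodesInit p → y ∈ nodes p → y ≢ x →
                    PathAvoiding x a y
  avoiding-prefix p x∉p y∈p y≢x with splitAt p y∈p
  ... | p₁ , p₂ , refl = p₁ , λ x∈p₁ → x∉p₁ (∈-++⁻ (nodesInit p₁) x∈p₁)
    where
      x∉p₁ : _ ∈ nodesInit p₁ ⊎ _ ∈ [ _ ] → ⊥
      x∉p₁ (inj₁ x∈p₁)        = x∉p (subst (_ ∈_) (sym (nodesInit-++ p₁ p₂)) (∈-++⁺ˡ x∈p₁))
      x∉p₁ (inj₂ (here refl)) = y≢x refl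

  record IsCycle {a} (c : Path a a) : Set where
    constructor isCycle
    field
      long   : 3 ≤ length (nodesInit c)
      unique : Unique (nodesInit c)

  record CycleThrough (x y : N) : Set where
    constructor cycleThrough
    field
      base    : N
      cycle   : Path base base
      cyclic  : IsCycle cycle
      x∈      : x ∈ nodesInit cycle
      y∈      : y ∈ nodesInit cycle

  cycleThroughOn : ∀ {a x y} (c : Path a a) {L} → nodesInit c ≡ L →
                   3 ≤ length L → Unique L → x ∈ L → y ∈ L → CycleThrough x y
  cycleThroughOn c refl long unique x∈ y∈ = cycleThrough _ c (isCycle long unique) x∈ y∈

  rotate : ∀ {a x} {c : Path a a} → IsCycle c → x ∈ nodesInit c →
           Σ (Path x x) λ c′ → IsCycle c′ × nodesInit c ⊆ nodesInit c′
  rotate {c = c} (isCycle long unique) x∈c with splitAt c (nodesInit⊆nodes c x∈c)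
  ... | p₁ , p₂ , refl rewrite nodesInit-++ p₁ p₂ =
    p₂ ++ₚ p₁ , cycle′ , ⊆-swap
    where
      swap : nodesInit (p₂ ++ₚ p₁) ≡ nodesInit p₂ ++ nodesInit p₁
      swap = nodesInit-++ p₂ p₁
      cycle′ : IsCycle (p₂ ++ₚ p₁)
      cycle′ = isCycle (subst (λ L → 3 ≤ length L) (sym swap)
                              (subst (3 ≤_) (length-++-comm (nodesInit p₁) _) long))
                       (subst Unique (sym swap) (Unique-++-comm (nodesInit p₁) unique))
      ⊆-swap : nodesInit p₁ ++ nodesInit p₂ ⊆ nodesInit (p₂ ++ₚ p₁)
      ⊆-swap z∈ = subst (_ ∈_) (sym swap) ([ ∈-++⁺ʳ (nodesInit p₂) , ∈-++⁺ˡ ]′ (∈-++⁻ (nodesInit p₁) z∈))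

  module _ (x : N) (R : N → Set) (R-closed : ∀ {y z} → Adj y z → y ≢ x → z ≢ x → R y → R z) where

    crossing : ∀ {y z} (p : Path y z) → R y → ¬ R z → x ∈ nodes p
    crossing []ₚ Ry ¬Rz = contradiction Ry ¬Rz
    crossing (_∷ₚ_ {y} {y′} y~y′ p) Ry ¬Rz with y ≟ x | y′ ≟ x
    ... | yes refl | _        = here refl
    ... | no _     | yes refl = there (start∈ p)
    ... | no y≢x   | no y′≢x  = there (crossing p (R-closed y~y′ y≢x y′≢x Ry) ¬Rz)

  -- Both arcs of the cycle between y and z would have to pass through x.
  cycle-across-separator :
    ∀ x (R : N → Set) → (∀ {y z} → Adj y z → y ≢ x → z ≢ x → R y → R z) →
    ∀ {a} {c : Path a a} → IsCycle c → ∀ {y z} →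
    y ∈ nodesInit c → z ∈ nodesInit c → y ≢ x → z ≢ x → R y → ¬ R z → ⊥
  cycle-across-separator x R R-closed isC y∈c z∈c y≢x z≢x Ry ¬Rz with rotate isC y∈c
  ... | c′ , isCycle _ unique , c⊆c′ with splitAt c′ (nodesInit⊆nodes c′ (c⊆c′ z∈c))
  ... | A , B , refl rewrite nodesInit-++ A B =
    proj₂ (proj₂ (Unique-++⁻ (nodesInit A) unique)) (x∈A , x∈B)
    where
      ¬R-closed : ∀ {y z} → Adj y z → y ≢ x → z ≢ x → ¬ R y → ¬ R z
      ¬R-closed y~z y≢x z≢x ¬Ry Rz = ¬Ry (R-closed (Adj-sym y~z) z≢x y≢x Rz)
      x∈A : x ∈ nodesInit A
      x∈A = ∈-nodes⇒∈-nodesInit A (crossing x R R-closed A Ry ¬Rz) (z≢x ∘ sym)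
      x∈B : x ∈ nodesInit B
      x∈B = ∈-nodes⇒∈-nodesInit B (crossing x (¬_ ∘ R) ¬R-closed B ¬Rz (λ ¬Ry → ¬Ry Ry)) (y≢x ∘ sym)

  module _ {S : N → Set} (S? : Decidable S) where

    private
      hit : ∀ {a b} (p : Path a b) → S b →
            ∃ λ z → Σ (Path a z) λ q → S z × (∀ {y} → y ∈ nodesInit q → ¬ S y) × nodes q ⊆ nodes p
      hit {b = b} []ₚ Sb = b , []ₚ , Sb , (λ ()) , λ z∈ → z∈
      hit (_∷ₚ_ {a} h p) Sb with S? a
      ... | yes Sa = a , []ₚ , Sa , (λ ()) , λ { (here refl) → here refl }
      ... | no ¬Sa with hit p Sb
      ...   | z , q , Sz , q-off , q⊆p =
        z , h ∷ₚ q , Sz , (λ { (here refl) → ¬Sa ; (there y∈) → q-off y∈ }) ,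
        λ { (here refl) → here refl ; (there y∈) → there (q⊆p y∈) }

    firstHit : ∀ {a b} (p : Path a b) → S b →
               ∃ λ z → Σ (Path a z) λ q →
                 S z × (∀ {y} → y ∈ nodesInit q → ¬ S y) × Simple q × nodes q ⊆ nodes p
    firstHit p Sb with hit p Sb
    ... | z , q , Sz , q-off , q⊆p with loopErase q
    ...   | q′ , q′-simple , q′⊆q = z , q′ , Sz , q′-off , q′-simple , λ y∈ → q⊆p (q′⊆q y∈)
      where
        q′-off : ∀ {y} → y ∈ nodesInit q′ → ¬ S y
        q′-off y∈ = q-off (∈-nodes⇒∈-nodesInit q (q′⊆q (nodesInit⊆nodes q′ y∈))
                                              λ { refl → Simple⇒end∉nodesInit q′ q′-simple y∈ })

  start∈nodesInit : ∀ {a b} → a ≢ b → (p : Path a b) → a ∈ nodesInit p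
  start∈nodesInit a≢b []ₚ      = contradiction refl a≢b
  start∈nodesInit a≢b (_ ∷ₚ _) = here refl

  length-nodes≥2 : ∀ {a b} → a ≢ b → (p : Path a b) → 2 ≤ length (nodes p)
  length-nodes≥2 a≢b []ₚ             = contradiction refl a≢b
  length-nodes≥2 a≢b (_ ∷ₚ []ₚ)      = s≤s (s≤s z≤n)
  length-nodes≥2 a≢b (_ ∷ₚ (_ ∷ₚ _)) = s≤s (s≤s z≤n)

  TwoConnected : Set
  TwoConnected = ∀ x a b → a ≢ x → b ≢ x → PathAvoiding x a b

  -- Whitney's theorem. Minimum degree 2 rules out a single edge, which is TwoConnected but acyclic.
  module Whitney (twoConnected : TwoConnected)
                 (otherNeighbour : ∀ b a → ∃ λ c → Adj b c × c ≢ a) where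

    simpleAvoiding : ∀ x a b → a ≢ x → b ≢ x → Σ (Path a b) λ p → Simple p × x ∉ nodes p
    simpleAvoiding x a b a≢x b≢x with twoConnected x a b a≢x b≢x
    ... | p , x∉p with loopErase p
    ...   | q , q-simple , q⊆p = q , q-simple , x∉p ∘ q⊆p

    Adj⇒≢ : ∀ {a b} → Adj a b → a ≢ b
    Adj⇒≢ a~b refl = Adj-irrefl a~b

    adjacent⇒cycleThrough : ∀ {a b} → Adj a b → CycleThrough a b
    adjacent⇒cycleThrough {a} {b} a~b with otherNeighbour b a
    ... | c , b~c , c≢a with simpleAvoiding b c a (Adj⇒≢ b~c ∘ sym) (Adj⇒≢ a~b)
    ... | Q , Q-simple , b∉Q =
      cycleThroughOn (b~c ∷ₚ (Q ++ₚ (a~b ∷ₚ []ₚ))) (cong (b ∷_) (nodesInit-++ Q (a~b ∷ₚ []ₚ)))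
        (s≤s (length-nodes≥2 c≢a Q)) (Unique-∷⁺ b∉Q Q-simple) (there (end∈ Q)) (here refl)

    -- A and B are the arcs between w and z of a cycle, and Q runs from v outside the cycle to z.
    -- Whichever arc contains u, closing it with Q and the edge v–w gives a cycle through v and u.
    module Ear {v w z} (v~w : Adj v w) (A : Path w z) (B : Path z w) (Q : Path v z)
               (AB-unique : Unique (nodesInit A ++ nodesInit B)) (Q-simple : Simple Q)
               (Q-off : ∀ {y} → y ∈ nodesInit Q → y ∉ nodesInit A ++ nodesInit B)
               (w∉Q : w ∉ nodes Q) (v≢z : v ≢ z) (z≢w : z ≢ w) where

      private
        A-unique : Unique (nodesInit A)
        A-unique = proj₁ (Unique-++⁻ (nodesInit A) AB-unique)
        B-unique : Unique (nodesInit B)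
        B-unique = proj₁ (proj₂ (Unique-++⁻ (nodesInit A) AB-unique))
        A-B-disjoint : Disjoint (nodesInit A) (nodesInit B)
        A-B-disjoint = proj₂ (proj₂ (Unique-++⁻ (nodesInit A) AB-unique))

      viaB : ∀ {u} → u ∈ nodesInit B → CycleThrough v u
      viaB u∈B =
        cycleThroughOn (Adj-sym v~w ∷ₚ (Q ++ₚ B)) (cong (w ∷_) (nodesInit-++ Q B))
          (s≤s (length-++-≥ (nodesInit Q) (length-∈ (start∈nodesInit v≢z Q))
                                          (length-∈ (start∈nodesInit z≢w B))))
          (Unique-∷⁺ w∉QB (Unique-++⁺ (Simple⇒Unique-nodesInit Q Q-simple) B-unique
                                      λ (y∈Q , y∈B) → Q-off y∈Q (∈-++⁺ʳ (nodesInit A) y∈B)))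
          (there (∈-++⁺ˡ (start∈nodesInit v≢z Q))) (there (∈-++⁺ʳ (nodesInit Q) u∈B))
        where
          w∉QB : w ∉ nodesInit Q ++ nodesInit B
          w∉QB w∈ with ∈-++⁻ (nodesInit Q) w∈
          ... | inj₁ w∈Q = w∉Q (nodesInit⊆nodes Q w∈Q)
          ... | inj₂ w∈B = A-B-disjoint (start∈nodesInit (z≢w ∘ sym) A , w∈B)

      viaA : ∀ {u} → u ∈ nodesInit A → CycleThrough v u
      viaA u∈A =
        cycleThroughOn (A ++ₚ (reverseₚ Q ++ₚ (v~w ∷ₚ []ₚ))) closing
          (length-++-≥ (nodesInit A) (length-∈ (start∈nodesInit (z≢w ∘ sym) A))
                       (subst (2 ≤_) (sym (length-reverse (nodes Q))) (length-nodes≥2 v≢z Q)))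
          (Unique-++⁺ A-unique (Unique-reverse⁺ Q-simple) A-Q-disjoint)
          (∈-++⁺ʳ (nodesInit A) (AnyP.reverse⁺ (start∈ Q))) (∈-++⁺ˡ u∈A)
        where
          closing : nodesInit (A ++ₚ (reverseₚ Q ++ₚ (v~w ∷ₚ []ₚ))) ≡ nodesInit A ++ reverse (nodes Q)
          closing = trans (nodesInit-++ A _)
                          (cong (nodesInit A ++_) (trans (nodesInit-++ (reverseₚ Q) _) (nodes-reverse Q)))
          A-Q-disjoint : Disjoint (nodesInit A) (reverse (nodes Q))
          A-Q-disjoint (y∈A , y∈Q) with ∈-++⁻ (nodesInit Q) (AnyP.reverse⁻ y∈Q)
          ... | inj₁ y∈Q′        = Q-off y∈Q′ (∈-++⁺ˡ y∈A)
          ... | inj₂ (here refl) = A-B-disjoint (y∈A , start∈nodesInit z≢w B)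

    extendCycle : ∀ {v w u} → Adj v w → w ≢ u → CycleThrough w u → CycleThrough v u
    extendCycle {v} {w} {u} v~w w≢u (cycleThrough _ c c-cyclic w∈c u∈c) with rotate c-cyclic w∈c
    ... | C , C-cyclic , c⊆C with v ∈? nodesInit C
    ... | yes v∈C = cycleThrough _ C C-cyclic v∈C (c⊆C u∈c)
    ... | no v∉C with simpleAvoiding w v u (Adj⇒≢ v~w) (w≢u ∘ sym)
    ... | Q , _ , w∉Q with firstHit (_∈? nodesInit C) Q (c⊆C u∈c)
    ... | z , Q′ , z∈C , Q′-off , Q′-simple , Q′⊆Q with splitAt C (nodesInit⊆nodes C z∈C)
    ... | A , B , refl =
      [ Ear.viaA v~w A B Q′ AB-unique Q′-simple Q′-off′ (w∉Q ∘ Q′⊆Q) v≢z z≢w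
      , Ear.viaB v~w A B Q′ AB-unique Q′-simple Q′-off′ (w∉Q ∘ Q′⊆Q) v≢z z≢w
      ]′ (∈-++⁻ (nodesInit A) (subst (u ∈_) (nodesInit-++ A B) (c⊆C u∈c)))
      where
        AB-unique : Unique (nodesInit A ++ nodesInit B)
        AB-unique = subst Unique (nodesInit-++ A B) (IsCycle.unique C-cyclic)
        Q′-off′ : ∀ {y} → y ∈ nodesInit Q′ → y ∉ nodesInit A ++ nodesInit B
        Q′-off′ y∈Q′ y∈AB = Q′-off y∈Q′ (subst (_ ∈_) (sym (nodesInit-++ A B)) y∈AB)
        v≢z : v ≢ z
        v≢z refl = v∉C z∈C
        z≢w : z ≢ w
        z≢w refl = w∉Q (Q′⊆Q (end∈ Q′))

    cycleThrough-path : ∀ {v u} → Path v u → v ≢ u → CycleThrough v u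
    cycleThrough-path []ₚ v≢u = contradiction refl v≢u
    cycleThrough-path {u = u} (_∷ₚ_ {b = w} v~w p) v≢u with w ≟ u
    ... | yes refl = adjacent⇒cycleThrough v~w
    ... | no w≢u   = extendCycle v~w w≢u (cycleThrough-path p w≢u)

  avoiding-via-cycle : ∀ {x a b a′ b′} → a′ ≢ x → b′ ≢ x → PathAvoiding x a a′ → PathAvoiding x b b′ →
                       CycleThrough a′ b′ → PathAvoiding x a b
  avoiding-via-cycle {x} {a} {b} a′≢x b′≢x a⇝a′ b⇝b′ (cycleThrough _ _ c-cyclic a′∈ b′∈)
    with pathAvoiding? x a b
  ... | yes a⇝b = a⇝b
  ... | no  a⇸b =
    ⊥-elim (cycle-across-separator x (PathAvoiding x a) (λ y~z _ z≢x a⇝y → avoiding-step a⇝y y~z z≢x)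
              c-cyclic a′∈ b′∈ a′≢x b′≢x a⇝a′ λ a⇝b′ → a⇸b (avoiding-trans a⇝b′ (avoiding-sym b⇝b′)))

  twoConnected-if-cycles : (P : N → Set) →
                           (∀ x a → a ≢ x → ∃ λ b → P b × b ≢ x × PathAvoiding x a b) →
                           (∀ {a b} → P a → P b → a ≢ b → CycleThrough a b) → TwoConnected
  twoConnected-if-cycles P toP cycles x a b a≢x b≢x with toP x a a≢x | toP x b b≢x
  ... | a′ , Pa′ , a′≢x , a⇝a′ | b′ , Pb′ , b′≢x , b⇝b′ with a′ ≟ b′
  ... | yes refl  = avoiding-trans a⇝a′ (avoiding-sym b⇝b′)
  ... | no a′≢b′ = avoiding-via-cycle a′≢x b′≢x a⇝a′ b⇝b′ (cycles Pa′ Pb′ a′≢b′)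

module Incidence {n m : ℕ} (ψ : Fin m → Subset n) where

  Node : Set
  Node = Fin n ⊎ Fin m

  Incident : Node → Node → Set
  Incident (inj₁ v) (inj₂ e) = v ∈ˢ ψ e
  Incident (inj₂ e) (inj₁ v) = v ∈ˢ ψ e
  Incident (inj₁ _) (inj₁ _) = ⊥
  Incident (inj₂ _) (inj₂ _) = ⊥

  incident? : ∀ x y → Dec (Incident x y)
  incident? (inj₁ v) (inj₂ e) = v ∈ˢ? ψ e
  incident? (inj₂ e) (inj₁ v) = v ∈ˢ? ψ e
  incident? (inj₁ _) (inj₁ _) = no λ ()
  incident? (inj₂ _) (inj₂ _) = no λ ()

  Incident-sym : ∀ {x y} → Incident x y → Incident y x
  Incident-sym {inj₁ _} {inj₂ _} v∈e = v∈e
  Incident-sym {inj₂ _} {inj₁ _} v∈e = v∈e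

  Incident-irrefl : ∀ {x} → ¬ Incident x x
  Incident-irrefl {inj₁ _} ()
  Incident-irrefl {inj₂ _} ()

  _≟ₙ_ : DecidableEquality Node
  _≟ₙ_ = ≡-dec Fin._≟_ Fin._≟_

  allNodes : List Node
  allNodes = map inj₁ (allFin n) ++ map inj₂ (allFin m)

  ∈-allNodes : ∀ x → x ∈ allNodes
  ∈-allNodes (inj₁ v) = ∈-++⁺ˡ (∈-map⁺ inj₁ (∈-allFin v))
  ∈-allNodes (inj₂ e) = ∈-++⁺ʳ (map inj₁ (allFin n)) (∈-map⁺ inj₂ (∈-allFin e))

  open Graph _≟ₙ_ Incident incident? Incident-sym Incident-irrefl allNodes ∈-allNodes public

  toPath : ∀ {Es u w} → Walk ψ Es u w → Path (inj₁ u) (inj₁ w)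
  toPath []                         = []ₚ
  toPath (step e _ (_ , u∈e , w∈e) W) = _∷ₚ_ {b = inj₂ e} u∈e (_∷ₚ_ {b = inj₁ _} w∈e (toPath W))

  module _ {Es : Subset m} where

    ∈-vertsInit⁺ : ∀ {u w v} (W : Walk ψ Es u w) → v ∈ vertsInit ψ W → inj₁ v ∈ nodesInit (toPath W)
    ∈-vertsInit⁺ (step _ _ _ W) (here refl) = here refl
    ∈-vertsInit⁺ (step _ _ _ W) (there v∈)  = there (there (∈-vertsInit⁺ W v∈))

    ∈-vertsInit⁻ : ∀ {u w v} (W : Walk ψ Es u w) → inj₁ v ∈ nodesInit (toPath W) → v ∈ vertsInit ψ W
    ∈-vertsInit⁻ (step _ _ _ W) (here refl)        = here refl
    ∈-vertsInit⁻ (step _ _ _ W) (there (there v∈)) = there (∈-vertsInit⁻ W v∈)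

    ∈-edgesOf⁺ : ∀ {u w f} (W : Walk ψ Es u w) → f ∈ edgesOf ψ W → inj₂ f ∈ nodesInit (toPath W)
    ∈-edgesOf⁺ (step _ _ _ W) (here refl) = there (here refl)
    ∈-edgesOf⁺ (step _ _ _ W) (there f∈)  = there (there (∈-edgesOf⁺ W f∈))

    ∈-edgesOf⁻ : ∀ {u w f} (W : Walk ψ Es u w) → inj₂ f ∈ nodesInit (toPath W) → f ∈ edgesOf ψ W
    ∈-edgesOf⁻ (step _ _ _ W) (there (here refl)) = here refl
    ∈-edgesOf⁻ (step _ _ _ W) (there (there f∈))  = there (∈-edgesOf⁻ W f∈)

    toPath-edges∈ : ∀ {u w f} (W : Walk ψ Es u w) → inj₂ f ∈ nodes (toPath W) → f ∈ˢ Es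
    toPath-edges∈ []               (here ())
    toPath-edges∈ (step _ e∈ _ W) (there (here refl)) = e∈
    toPath-edges∈ (step _ _  _ W) (there (there f∈))  = toPath-edges∈ W f∈

    toPath-unique⁺ : ∀ {u w} (W : Walk ψ Es u w) → Unique (vertsInit ψ W) → Unique (edgesOf ψ W) →
                     Unique (nodesInit (toPath W))
    toPath-unique⁺ []              _  _  = []
    toPath-unique⁺ (step _ _ _ W) uv ue =
      Unique-∷⁺ (λ { (here ()) ; (there u∈) → Unique[x∷xs]⇒x∉xs uv (∈-vertsInit⁻ W u∈) })
        (Unique-∷⁺ (Unique[x∷xs]⇒x∉xs ue ∘ ∈-edgesOf⁻ W)
          (toPath-unique⁺ W (Unique-tail uv) (Unique-tail ue)))

    toPath-unique⁻ : ∀ {u w} (W : Walk ψ Es u w) → Unique (nodesInit (toPath W)) →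
                     Unique (vertsInit ψ W) × Unique (edgesOf ψ W)
    toPath-unique⁻ []             _ = [] , []
    toPath-unique⁻ (step _ _ _ W) u with toPath-unique⁻ W (Unique-tail (Unique-tail u))
    ... | uv , ue = Unique-∷⁺ (Unique[x∷xs]⇒x∉xs u ∘ there ∘ ∈-vertsInit⁺ W) uv
                  , Unique-∷⁺ (Unique[x∷xs]⇒x∉xs (Unique-tail u) ∘ ∈-edgesOf⁺ W) ue

    fromPath : ∀ {a b} (p : Path (inj₁ a) (inj₁ b)) → Simple p →
               (∀ {f} → inj₂ f ∈ nodes p → f ∈ˢ Es) → Walk ψ Es a b
    fromPath []ₚ _ _ = []
    fromPath (_∷ₚ_ {b = inj₂ e} a∈e (_∷ₚ_ {b = inj₁ c} c∈e p)) simple edges∈ =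
      step e (edges∈ (there (here refl)))
           ((λ { refl → Unique[x∷xs]⇒x∉xs simple (there (start∈ p)) }) , a∈e , c∈e)
        (fromPath p (Unique-tail (Unique-tail simple)) (λ f∈ → edges∈ (there (there f∈))))

    toPath∘fromPath : ∀ {a b} (p : Path (inj₁ a) (inj₁ b)) (simple : Simple p)
                      (edges∈ : ∀ {f} → inj₂ f ∈ nodes p → f ∈ˢ Es) → toPath (fromPath p simple edges∈) ≡ p
    toPath∘fromPath []ₚ _ _ = refl
    toPath∘fromPath (_∷ₚ_ {b = inj₂ e} a∈e (_∷ₚ_ {b = inj₁ c} c∈e p)) simple edges∈ =
      cong (λ q → a∈e ∷ₚ c∈e ∷ₚ q) (toPath∘fromPath p _ _)

    pathToWalk : ∀ {a b} (p : Path (inj₁ a) (inj₁ b)) → (∀ {f} → inj₂ f ∈ nodes p → f ∈ˢ Es) →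
                 Walk ψ Es a b
    pathToWalk p edges∈ with loopErase p
    ... | q , q-simple , q⊆p = fromPath q q-simple (edges∈ ∘ q⊆p)

  avoidingEdge⇔walk : ∀ e u w → PathAvoiding (inj₂ e) (inj₁ u) (inj₁ w) ⇔ Walk ψ (⊤ - e) u w
  avoidingEdge⇔walk e u w =
    mk⇔ (λ (p , e∉p) → pathToWalk p λ f∈p → x∈p∧x≢y⇒x∈p-y ∈⊤ λ { refl → e∉p f∈p })
        (λ W → toPath W , λ e∈W → x∉p-x ⊤ e (toPath-edges∈ W e∈W))

  ElemOn⇒∈-toPath : ∀ (D : Cycle ψ) {x} → ElemOn ψ x D → x ∈ nodesInit (toPath (Cycle.walk D))
  ElemOn⇒∈-toPath D {inj₁ v} = ∈-vertsInit⁺ (Cycle.walk D)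
  ElemOn⇒∈-toPath D {inj₂ e} = ∈-edgesOf⁺ (Cycle.walk D)

  ∈-toPath⇒ElemOn : ∀ (D : Cycle ψ) {x} → x ∈ nodesInit (toPath (Cycle.walk D)) → ElemOn ψ x D
  ∈-toPath⇒ElemOn D {inj₁ v} = ∈-vertsInit⁻ (Cycle.walk D)
  ∈-toPath⇒ElemOn D {inj₂ e} = ∈-edgesOf⁻ (Cycle.walk D)

  private
    toPath-long⁺ : ∀ {u w} (W : Walk ψ ⊤ u w) → 2 ≤ length (edgesOf ψ W) → 3 ≤ length (nodesInit (toPath W))
    toPath-long⁺ (step _ _ _ [])             (s≤s ())
    toPath-long⁺ (step _ _ _ (step _ _ _ _)) _ = s≤s (s≤s (s≤s z≤n))

    toPath-long⁻ : ∀ {u w} (W : Walk ψ ⊤ u w) → 3 ≤ length (nodesInit (toPath W)) → 2 ≤ length (edgesOf ψ W)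
    toPath-long⁻ (step _ _ _ [])             (s≤s (s≤s ()))
    toPath-long⁻ (step _ _ _ (step _ _ _ _)) _ = s≤s (s≤s z≤n)

  cycle⇒cycleThrough : ∀ (D : Cycle ψ) {x y} → ElemOn ψ x D → ElemOn ψ y D → CycleThrough x y
  cycle⇒cycleThrough D x∈D y∈D =
    cycleThrough _ (toPath W)
      (isCycle (toPath-long⁺ W (Cycle.long D)) (toPath-unique⁺ W (Cycle.vdist D) (Cycle.edist D)))
      (ElemOn⇒∈-toPath D x∈D) (ElemOn⇒∈-toPath D y∈D)
    where W = Cycle.walk D

  private
    walkCycle : ∀ {a} (W : Walk ψ ⊤ a a) → IsCycle (toPath W) → Cycle ψ
    walkCycle W (isCycle long unique) = record
      { base = _ ; walk = W ; long = toPath-long⁻ W long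
      ; vdist = proj₁ (toPath-unique⁻ W unique) ; edist = proj₂ (toPath-unique⁻ W unique) }

    -- Splitting off the first edge leaves a simple path, which fromPath turns into a walk.
    closedPathWalk : ∀ {a} (c : Path (inj₁ a) (inj₁ a)) → IsCycle c → Σ (Walk ψ ⊤ a a) λ W → toPath W ≡ c
    closedPathWalk {a} (_∷ₚ_ {b = inj₂ e} a∈e (_∷ₚ_ {b = inj₁ b} b∈e p@(_ ∷ₚ _))) (isCycle _ unique) =
      step e ∈⊤ (a≢b , a∈e , b∈e) (fromPath p p-simple λ _ → ∈⊤) ,
      cong (λ q → a∈e ∷ₚ b∈e ∷ₚ q) (toPath∘fromPath p p-simple λ _ → ∈⊤)
      where
        a∉p : inj₁ a ∉ nodesInit p
        a∉p = Unique[x∷xs]⇒x∉xs unique ∘ there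
        a≢b : a ≢ b
        a≢b refl = a∉p (here refl)
        p-simple : Simple p
        p-simple = Unique-++-comm [ inj₁ a ] (Unique-∷⁺ a∉p (Unique-tail (Unique-tail unique)))
    closedPathWalk (_∷ₚ_ {b = inj₂ e} _ (_∷ₚ_ {b = inj₁ b} _ []ₚ)) (isCycle (s≤s (s≤s ())) _)

    atVertex : ∀ {a} {c : Path a a} → IsCycle c →
               Σ (Fin n) λ v → Σ (Path (inj₁ v) (inj₁ v)) λ c′ → IsCycle c′ × nodesInit c ⊆ nodesInit c′
    atVertex {inj₁ v} {c} c-cyclic = v , c , c-cyclic , λ x∈ → x∈
    atVertex {inj₂ e} {_∷ₚ_ {b = inj₁ v} _ p} c-cyclic =
      v , rotate c-cyclic (there (start∈nodesInit (λ ()) p))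

  cycleThrough⇒cycle : ∀ {x y} → CycleThrough x y → Σ (Cycle ψ) λ D → ElemOn ψ x D × ElemOn ψ y D
  cycleThrough⇒cycle (cycleThrough _ c c-cyclic x∈ y∈) with atVertex c-cyclic
  ... | _ , c′ , c′-cyclic , c⊆c′ with closedPathWalk c′ c′-cyclic
  ... | W , refl = D , ∈-toPath⇒ElemOn D (c⊆c′ x∈) , ∈-toPath⇒ElemOn D (c⊆c′ y∈)
    where D = walkCycle W c′-cyclic

  connectedSub-from-anchor :
    ∀ (S : Node → Set) {o} (V : Subset n) (E : Subset m) →
    (∀ f → f ∈ˢ E → ψ f ⊆ˢ V) → (∀ {w} → w ∈ˢ V → S (inj₁ w)) → (∀ {f} → S (inj₂ f) → f ∈ˢ E) →
    (∀ {z} → S z → Σ (Path o z) λ p → ∀ {y} → y ∈ nodes p → S y) →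
    ConnectedSub ψ V E
  connectedSub-from-anchor S V E E⊆V V⊆S S⊆E anchored = E⊆V , walk
    where
      walk : ∀ u w → u ∈ˢ V → w ∈ˢ V → u ≢ w → Walk ψ E u w
      walk u w u∈V w∈V _ with anchored (V⊆S u∈V) | anchored (V⊆S w∈V)
      ... | p , p⊆S | q , q⊆S =
        pathToWalk (reverseₚ p ++ₚ q)
          λ f∈ → S⊆E ([ p⊆S ∘ ∈-nodes-reverse⁻ p , q⊆S ]′ (∈-nodes-++⁻ (reverseₚ p) q f∈))

module Conditions {n m : ℕ} (ψ : Fin m → Subset n) (connected : Connected ψ) (2≤n : 2 ≤ n)
                  (2≤∣e∣ : ∀ e → 2 ≤ ∣ ψ e ∣) (2≤deg : ∀ v → 2 ≤ degree ψ v) where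

  open Incidence ψ

  private
    edgesAt : Fin n → Subset m
    edgesAt v = tabulate (λ e → lookup (ψ e) v)

    ∈-edgesAt : ∀ {v f} → f ∈ˢ edgesAt v → v ∈ˢ ψ f
    ∈-edgesAt {v} {f} f∈ = lookup⇒[]= v (ψ f) (∈-tabulate⁻ f∈)

  otherNeighbour : ∀ b a → ∃ λ c → Incident b c × c ≢ a
  otherNeighbour (inj₁ v) (inj₂ j) with ∣p∣≥2⇒∃≢ (edgesAt v) (2≤deg v) j
  ... | f , f∈ , f≢j = inj₂ f , ∈-edgesAt f∈ , f≢j ∘ inj₂-injective
  otherNeighbour (inj₁ v) (inj₁ _) with ∣p∣≥1⇒nonempty (edgesAt v) (<⇒≤ (2≤deg v))
  ... | f , f∈ = inj₂ f , ∈-edgesAt f∈ , λ ()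
  otherNeighbour (inj₂ e) (inj₁ j) with ∣p∣≥2⇒∃≢ (ψ e) (2≤∣e∣ e) j
  ... | u , u∈ , u≢j = inj₁ u , u∈ , u≢j ∘ inj₁-injective
  otherNeighbour (inj₂ e) (inj₂ _) with ∣p∣≥1⇒nonempty (ψ e) (<⇒≤ (2≤∣e∣ e))
  ... | u , u∈ = inj₁ u , u∈ , λ ()

  toVertex : ∀ x a → a ≢ x → ∃ λ v → inj₁ v ≢ x × PathAvoiding x a (inj₁ v)
  toVertex x (inj₁ v) a≢x = v , a≢x , avoiding-refl a≢x
  toVertex x (inj₂ e) a≢x with otherNeighbour (inj₂ e) x
  ... | inj₁ v , v∈e , v≢x = v , v≢x , avoiding-step (avoiding-refl a≢x) v∈e v≢x

  toEdge : ∀ x a → a ≢ x → ∃ λ f → inj₂ f ≢ x × PathAvoiding x a (inj₂ f)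
  toEdge x (inj₂ f) a≢x = f , a≢x , avoiding-refl a≢x
  toEdge x (inj₁ v) a≢x with otherNeighbour (inj₁ v) x
  ... | inj₂ f , v∈f , f≢x = f , f≢x , avoiding-step (avoiding-refl a≢x) v∈f f≢x

  walkBetween : ∀ u w → Walk ψ ⊤ u w
  walkBetween u w with u Fin.≟ w
  ... | yes refl = []
  ... | no u≢w   = connected u w u≢w

  private
    toSomeVertex : ∀ a → ∃ λ v → Path a (inj₁ v)
    toSomeVertex (inj₁ v) = v , []ₚ
    toSomeVertex (inj₂ e) with otherNeighbour (inj₂ e) (inj₂ e)
    ... | inj₁ v , v∈e , _ = v , v∈e ∷ₚ []ₚ

  pathBetween : ∀ a b → Path a b
  pathBetween a b with toSomeVertex a | toSomeVertex b
  ... | u , a⇝u | w , b⇝w = a⇝u ++ₚ toPath (walkBetween u w) ++ₚ reverseₚ b⇝w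

  v₀ : Fin n
  v₀ = Fin.fromℕ< (<⇒≤ 2≤n)

  twoConnected⇒cond2 : TwoConnected → Cond2 ψ
  twoConnected⇒cond2 twoConnected x y x≢y =
    cycleThrough⇒cycle (Whitney.cycleThrough-path twoConnected otherNeighbour (pathBetween x y) x≢y)

  cond2⇒cond3 : Cond2 ψ → Cond3 ψ
  cond2⇒cond3 cond2 u v u≢v = cond2 (inj₁ u) (inj₁ v) (u≢v ∘ inj₁-injective)

  cond2⇒cond4 : Cond2 ψ → Cond4 ψ
  cond2⇒cond4 cond2 e f e≢f = cond2 (inj₂ e) (inj₂ f) (e≢f ∘ inj₂-injective)

  cond3⇒twoConnected : Cond3 ψ → TwoConnected
  cond3⇒twoConnected cond3 = twoConnected-if-cycles (λ x → ∃ λ v → x ≡ inj₁ v) toVertex′ cycles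
    where
      toVertex′ : ∀ x a → a ≢ x → ∃ λ b → (∃ λ v → b ≡ inj₁ v) × b ≢ x × PathAvoiding x a b
      toVertex′ x a a≢x with toVertex x a a≢x
      ... | v , v≢x , a⇝v = inj₁ v , (v , refl) , v≢x , a⇝v
      cycles : ∀ {a b} → (∃ λ v → a ≡ inj₁ v) → (∃ λ v → b ≡ inj₁ v) → a ≢ b → CycleThrough a b
      cycles (u , refl) (v , refl) u≢v with cond3 u v (u≢v ∘ cong inj₁)
      ... | D , u∈D , v∈D = cycle⇒cycleThrough D u∈D v∈D

  cond4⇒twoConnected : Cond4 ψ → TwoConnected
  cond4⇒twoConnected cond4 = twoConnected-if-cycles (λ x → ∃ λ f → x ≡ inj₂ f) toEdge′ cycles
    where
      toEdge′ : ∀ x a → a ≢ x → ∃ λ b → (∃ λ f → b ≡ inj₂ f) × b ≢ x × PathAvoiding x a b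
      toEdge′ x a a≢x with toEdge x a a≢x
      ... | f , f≢x , a⇝f = inj₂ f , (f , refl) , f≢x , a⇝f
      cycles : ∀ {a b} → (∃ λ f → a ≡ inj₂ f) → (∃ λ f → b ≡ inj₂ f) → a ≢ b → CycleThrough a b
      cycles (e , refl) (f , refl) e≢f with cond4 e f (e≢f ∘ cong inj₂)
      ... | D , e∈D , f∈D = cycle⇒cycleThrough D e∈D f∈D

  twoConnected⇒noSeparatingVertex : TwoConnected → ∀ v → ¬ SeparatingVertex ψ v
  twoConnected⇒noSeparatingVertex twoConnected v
    (V₁ , E₁ , V₂ , E₂ , (E₁⊆V₁ , _) , (E₂⊆V₂ , _) , (e₁ , e₁∈E₁) , (e₂ , e₂∈E₂) , _ , _ , E₁∪E₂≡⊤ , V₁∩V₂≡v)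
    with ∣p∣≥2⇒∃≢ (ψ e₁) (2≤∣e∣ e₁) v | ∣p∣≥2⇒∃≢ (ψ e₂) (2≤∣e∣ e₂) v
  ... | u₁ , u₁∈e₁ , u₁≢v | u₂ , u₂∈e₂ , u₂≢v
    with twoConnected (inj₁ v) (inj₁ u₁) (inj₁ u₂) (u₁≢v ∘ inj₁-injective) (u₂≢v ∘ inj₁-injective)
  ... | p , v∉p = v∉p (crossing (inj₁ v) Side₁ Side₁-closed p (E₁⊆V₁ e₁ e₁∈E₁ u₁∈e₁) u₂∉V₁)
    where
      Side₁ : Node → Set
      Side₁ (inj₁ y) = y ∈ˢ V₁
      Side₁ (inj₂ f) = f ∈ˢ E₁
      only-v : ∀ {y} → y ∈ˢ V₁ → y ∈ˢ V₂ → y ≡ v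
      only-v y∈V₁ y∈V₂ = x∈⁅y⁆⇒x≡y v (subst (_ ∈ˢ_) V₁∩V₂≡v (x∈p∩q⁺ (y∈V₁ , y∈V₂)))
      Side₁-closed : ∀ {y z} → Incident y z → y ≢ inj₁ v → z ≢ inj₁ v → Side₁ y → Side₁ z
      Side₁-closed {inj₁ y} {inj₂ f} y∈f y≢v _ y∈V₁ with x∈p∪q⁻ E₁ E₂ (subst (f ∈ˢ_) (sym E₁∪E₂≡⊤) ∈⊤)
      ... | inj₁ f∈E₁ = f∈E₁
      ... | inj₂ f∈E₂ = contradiction (cong inj₁ (only-v y∈V₁ (E₂⊆V₂ f f∈E₂ y∈f))) y≢v
      Side₁-closed {inj₂ f} {inj₁ y} y∈f _ _ f∈E₁ = E₁⊆V₁ f f∈E₁ y∈f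
      u₂∉V₁ : ¬ Side₁ (inj₁ u₂)
      u₂∉V₁ u₂∈V₁ = u₂≢v (only-v u₂∈V₁ (E₂⊆V₂ e₂ e₂∈E₂ u₂∈e₂))

  twoConnected⇒walkWithout : TwoConnected → ∀ e u w → Walk ψ (⊤ - e) u w
  twoConnected⇒walkWithout twoConnected e u w =
    Equivalence.to (avoidingEdge⇔walk e u w) (twoConnected (inj₂ e) (inj₁ u) (inj₁ w) (λ ()) (λ ()))

  twoConnected⇒noCutEdge : TwoConnected → ∀ e → ¬ CutEdge ψ e
  -- c < c′ ≤ 1 forces c = 0, leaving no component for v₀.
  twoConnected⇒noCutEdge twoConnected e (c , c′ , (f , _) , H-e , c<c′)
    with ≤-trans c<c′ (numClasses-total⇒≤1 H-e (twoConnected⇒walkWithout twoConnected e)) | f v₀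
  ... | s≤s z≤n | ()

  separated⇒cutEdge : ∀ e {a b} → a ≢ inj₂ e → b ≢ inj₂ e → ¬ PathAvoiding (inj₂ e) a b → CutEdge ψ e
  separated⇒cutEdge e {a} {b} a≢e b≢e a⇸b
    with toVertex (inj₂ e) a a≢e | toVertex (inj₂ e) b b≢e
       | numberClasses (λ u w → PathAvoiding (inj₂ e) (inj₁ u) (inj₁ w))
                       (λ _ _ → pathAvoiding? _ _ _) (avoiding-refl λ ()) avoiding-sym avoiding-trans
  ... | u , _ , a⇝u | w , _ , b⇝w | c′ , H-e =
    1 , c′ , numClasses-total walkBetween v₀ , numClasses-resp-⇔ (avoidingEdge⇔walk e) H-e ,
    numClasses-separated⇒≥2 H-e λ u⇝w → a⇸b (avoiding-trans a⇝u (avoiding-trans u⇝w (avoiding-sym b⇝w)))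

  -- The two sides of v: the nodes reachable from a without passing v, and the others; both with v.
  module Separation (v : Fin n) {a b : Node} (a≢v : a ≢ inj₁ v) (b≢v : b ≢ inj₁ v)
                    (a⇸b : ¬ PathAvoiding (inj₁ v) a b) where

    private
      x : Node
      x = inj₁ v

      Near : Node → Set
      Near = PathAvoiding x a

      near? : ∀ y → Dec (Near y)
      near? = pathAvoiding? x a

      Side₁ Side₂ : Node → Set
      Side₁ y = y ≡ x ⊎ Near y
      Side₂ y = y ≡ x ⊎ ¬ Near y

      toSeparator : ∀ z → Σ (Path z x) λ q → ∀ {y} → y ∈ nodes q → y ≢ x → PathAvoiding x z y
      toSeparator z with firstHit (_≟ₙ x) (pathBetween z x) refl
      ... | _ , q , refl , q-off , _ = q , λ y∈q → avoiding-prefix q (λ x∈q → q-off x∈q refl) y∈q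

      separatorOr : ∀ {P : Node → Set} y → (y ≢ x → P y) → y ≡ x ⊎ P y
      separatorOr y P-y with y ≟ₙ x
      ... | yes y≡x = inj₁ y≡x
      ... | no  y≢x = inj₂ (P-y y≢x)

      anchored₁ : ∀ {z} → Side₁ z → Σ (Path a z) λ p → ∀ {y} → y ∈ nodes p → Side₁ y
      anchored₁ (inj₂ (p , x∉p)) =
        p , λ y∈p → inj₂ (avoiding-prefix p (x∉p ∘ nodesInit⊆nodes p) y∈p λ { refl → x∉p y∈p })
      anchored₁ (inj₁ refl) with toSeparator a
      ... | q , prefixes = q , λ y∈q → separatorOr {Near} _ (prefixes y∈q)

      anchored₂ : ∀ {z} → Side₂ z → Σ (Path x z) λ p → ∀ {y} → y ∈ nodes p → Side₂ y
      anchored₂ (inj₁ refl) = []ₚ , λ { (here refl) → inj₁ refl }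
      anchored₂ {z} (inj₂ far) with toSeparator z
      ... | q , prefixes =
        reverseₚ q , λ y∈ → separatorOr {¬_ ∘ Near} _ λ y≢x a⇝y →
          far (avoiding-trans a⇝y (avoiding-sym (prefixes (∈-nodes-reverse⁻ q y∈) y≢x)))

      side₁? : ∀ w → Dec (Side₁ (inj₁ w))
      side₁? w = (inj₁ w ≟ₙ x) ⊎-dec near? (inj₁ w)

      side₂? : ∀ w → Dec (Side₂ (inj₁ w))
      side₂? w = (inj₁ w ≟ₙ x) ⊎-dec ¬? (near? (inj₁ w))

      nearEdge? farEdge? : ∀ f → Dec _
      nearEdge? f = near? (inj₂ f)
      farEdge?  f = ¬? (near? (inj₂ f))

      V₁ V₂ : Subset n
      V₁ = subsetOf side₁?
      V₂ = subsetOf side₂?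

      E₁ E₂ : Subset m
      E₁ = subsetOf nearEdge?
      E₂ = subsetOf farEdge?

      E₁⊆V₁ : ∀ f → f ∈ˢ E₁ → ψ f ⊆ˢ V₁
      E₁⊆V₁ f f∈E₁ {y} y∈f =
        ∈-subsetOf⁺ side₁? (separatorOr {Near} (inj₁ y) (avoiding-step (∈-subsetOf⁻ nearEdge? f∈E₁) y∈f))

      E₂⊆V₂ : ∀ f → f ∈ˢ E₂ → ψ f ⊆ˢ V₂
      E₂⊆V₂ f f∈E₂ {y} y∈f =
        ∈-subsetOf⁺ side₂? (separatorOr {¬_ ∘ Near} (inj₁ y) λ _ a⇝y →
          ∈-subsetOf⁻ farEdge? f∈E₂ (avoiding-step a⇝y y∈f λ ()))

      Side₁⊆E₁ : ∀ {f} → Side₁ (inj₂ f) → f ∈ˢ E₁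
      Side₁⊆E₁ (inj₂ a⇝f) = ∈-subsetOf⁺ nearEdge? a⇝f

      Side₂⊆E₂ : ∀ {f} → Side₂ (inj₂ f) → f ∈ˢ E₂
      Side₂⊆E₂ (inj₂ a⇸f) = ∈-subsetOf⁺ farEdge? a⇸f

      V₁∪V₂≡⊤ : V₁ ∪ V₂ ≡ ⊤
      V₁∪V₂≡⊤ = ⊆-antisym (⊆-max _) λ {w} _ → x∈p∪q⁺ (side (near? (inj₁ w)))
        where
          side : ∀ {w} → Dec (Near (inj₁ w)) → w ∈ˢ V₁ ⊎ w ∈ˢ V₂
          side (yes a⇝w) = inj₁ (∈-subsetOf⁺ side₁? (inj₂ a⇝w))
          side (no  a⇸w) = inj₂ (∈-subsetOf⁺ side₂? (inj₂ a⇸w))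

      E₁∪E₂≡⊤ : E₁ ∪ E₂ ≡ ⊤
      E₁∪E₂≡⊤ = ⊆-antisym (⊆-max _) λ {f} _ → x∈p∪q⁺ (side (near? (inj₂ f)))
        where
          side : ∀ {f} → Dec (Near (inj₂ f)) → f ∈ˢ E₁ ⊎ f ∈ˢ E₂
          side (yes a⇝f) = inj₁ (∈-subsetOf⁺ nearEdge? a⇝f)
          side (no  a⇸f) = inj₂ (∈-subsetOf⁺ farEdge? a⇸f)

      V₁∩V₂≡⁅v⁆ : V₁ ∩ V₂ ≡ ⁅ v ⁆
      V₁∩V₂≡⁅v⁆ = ⊆-antisym (λ w∈ → only-v (x∈p∩q⁻ V₁ V₂ w∈)) λ w∈⁅v⁆ → v-in (x∈⁅y⁆⇒x≡y v w∈⁅v⁆)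
        where
          on-both : ∀ {w} → Side₁ (inj₁ w) → Side₂ (inj₁ w) → w ≡ v
          on-both (inj₁ w≡v) _           = inj₁-injective w≡v
          on-both (inj₂ _)   (inj₁ w≡v)  = inj₁-injective w≡v
          on-both (inj₂ a⇝w) (inj₂ a⇸w) = contradiction a⇝w a⇸w
          only-v : ∀ {w} → w ∈ˢ V₁ × w ∈ˢ V₂ → w ∈ˢ ⁅ v ⁆
          only-v (w∈V₁ , w∈V₂) =
            subst (_∈ˢ ⁅ v ⁆) (sym (on-both (∈-subsetOf⁻ side₁? w∈V₁) (∈-subsetOf⁻ side₂? w∈V₂))) (x∈⁅x⁆ v)
          v-in : ∀ {w} → w ≡ v → w ∈ˢ V₁ ∩ V₂
          v-in refl = x∈p∩q⁺ (∈-subsetOf⁺ side₁? (inj₁ refl) , ∈-subsetOf⁺ side₂? (inj₁ refl))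

      E₁-nonempty : Nonempty E₁
      E₁-nonempty with toEdge x a a≢v
      ... | f , _ , a⇝f = f , ∈-subsetOf⁺ nearEdge? a⇝f

      E₂-nonempty : Nonempty E₂
      E₂-nonempty with toEdge x b b≢v
      ... | f , _ , b⇝f = f , ∈-subsetOf⁺ farEdge? λ a⇝f → a⇸b (avoiding-trans a⇝f (avoiding-sym b⇝f))

    separatingVertex : SeparatingVertex ψ v
    separatingVertex =
      V₁ , E₁ , V₂ , E₂ ,
      connectedSub-from-anchor Side₁ V₁ E₁ E₁⊆V₁ (∈-subsetOf⁻ side₁?) Side₁⊆E₁ anchored₁ ,
      connectedSub-from-anchor Side₂ V₂ E₂ E₂⊆V₂ (∈-subsetOf⁻ side₂?) Side₂⊆E₂ anchored₂ ,
      E₁-nonempty , E₂-nonempty ,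
      (λ (f , f∈) → let f∈E₁ , f∈E₂ = x∈p∩q⁻ E₁ E₂ f∈
                    in ∈-subsetOf⁻ farEdge? f∈E₂ (∈-subsetOf⁻ nearEdge? f∈E₁)) ,
      V₁∪V₂≡⊤ , E₁∪E₂≡⊤ , V₁∩V₂≡⁅v⁆

  cond1⇒twoConnected : Cond1 ψ → TwoConnected
  cond1⇒twoConnected _ x a b a≢x b≢x with pathAvoiding? x a b
  ... | yes a⇝b = a⇝b
  cond1⇒twoConnected (noSeparatingVertex , _) (inj₁ v) a b a≢v b≢v | no a⇸b =
    contradiction (Separation.separatingVertex v a≢v b≢v a⇸b) (noSeparatingVertex v)
  cond1⇒twoConnected (_ , noCutEdge) (inj₂ e) a b a≢e b≢e | no a⇸b =
    contradiction (separated⇒cutEdge e a≢e b≢e a⇸b) (noCutEdge e)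

  twoConnected⇒cond1 : TwoConnected → Cond1 ψ
  twoConnected⇒cond1 twoConnected =
    twoConnected⇒noSeparatingVertex twoConnected , twoConnected⇒noCutEdge twoConnected

theorem3p46 : ∀ {n m : ℕ} (ψ : Fin m → Subset n) →
    Connected ψ → 2 ≤ n →
    (∀ e → 2 ≤ ∣ ψ e ∣) → (∀ v → 2 ≤ degree ψ v) →
    (Cond1 ψ ⇔ Cond2 ψ) × (Cond1 ψ ⇔ Cond3 ψ) × (Cond1 ψ ⇔ Cond4 ψ)
theorem3p46 ψ connected 2≤n 2≤∣e∣ 2≤deg =
  mk⇔ (twoConnected⇒cond2 ∘ cond1⇒twoConnected) (twoConnected⇒cond1 ∘ cond3⇒twoConnected ∘ cond2⇒cond3) ,
  mk⇔ (cond2⇒cond3 ∘ twoConnected⇒cond2 ∘ cond1⇒twoConnected) (twoConnected⇒cond1 ∘ cond3⇒twoConnected) ,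
  mk⇔ (cond2⇒cond4 ∘ twoConnected⇒cond2 ∘ cond1⇒twoConnected) (twoConnected⇒cond1 ∘ cond4⇒twoConnected)
  where open Conditions ψ connected 2≤n 2≤∣e∣ 2≤deg
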